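{- For every $e\in\mathcal E(X)$, $1\cap e\equiv\sum_{C\in I(e)}t_C$ (the empty sum being $0$).
   Context: Fix a set $X$ of variables. Expressions $\mathcal E(X)$ are generated by $e,f::= x \mid 0\mid 1\mid e+f\mid e\cdot f\mid e\cap f\mid e^+\mid \overline{e}$. For a finite $A=\{a_1,\dots,a_n\}\subseteq X$ (any order), $t_A=a_1\cap(a_2\cap(\cdots\cap(a_n\cap 1)\cdots))$, $t_\emptyset=1$. The function $I$ from expressions to finite sets of finite subsets of $X$ is defined by: $I(0)=\emptyset$, $I(1)=\{\emptyset\}$, $I(x)=\{\{x\}\}$, $I(e+f)=I(e)\cup I(f)$, $I(e\cdot f)=I(e\cap f)=\{A\cup B:(A,B)\in I(e)\times I(f)\}$, $I(e^+)=I(\overline e)=I(e)$. The relation $\equiv$ is the smallest congruence on $\mathcal E(X)$ containing, for all $e,f,g$: $e+f=f+e$; $e+(f+g)=(e+f)+g$; $e+0=e$; $e\cap f=f\cap e$; $e\cap e=e$; $e\cap(f\cap g)=(e\cap f)\cap g$; $(e+f)\cap g=e\cap g+f\cap g$; $(e\cap f)+e=e$; $e\cdot(f\cdot g)=(e\cdot f)\cdot g$; $e\cdot 0=0=0\cdot e$; $(e+f)\cdot g=e\cdot g+f\cdot g$; $e\cdot(f+g)=e\cdot f+e\cdot g$; $e^+=e+e\cdot e^+$; $e^+=e+e^+\cdot e$; $\overline{\overline e}=e$; $\overline{e+f}=\overline e+\overline f$; $\overline{e\cdot f}=\overline f\cdot\overline e$; $\overline{e\cap f}=\overline e\cap\overline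 f$; $\overline{e^+}=\overline e^{\,+}$; $1\cdot e=e=e\cdot 1$; $1\cap(e\cdot f)=1\cap(e\cap f)$; $1\cap\overline e=1\cap e$; $(1\cap e)\cdot f=f\cdot(1\cap e)$; $((1\cap e)\cdot f)\cap g=(1\cap e)\cdot(f\cap g)$; $(g+(1\cap e)\cdot f)^+=g^++(1\cap e)\cdot(g+f)^+$; and closed under: if $e\cdot f+f\equiv f$ then $e^+\cdot f+f\equiv f$; if $f\cdot e+f\equiv f$ then $f\cdot e^++f\equiv f$. -}

module Defs where

open import Data.List using (List; []; _∷_; _++_; concatMap; map; foldr)

infixl 6 _⊕_
infixl 7 _⊙_
infixl 8 _⊓_
infix 4 _≈_

data Exp (X : Set) : Set where
  var  : X → Exp X
  𝟘    : Exp X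
  𝟙    : Exp X
  _⊕_  : Exp X → Exp X → Exp X
  _⊙_  : Exp X → Exp X → Exp X
  _⊓_  : Exp X → Exp X → Exp X
  _⁺   : Exp X → Exp X
  conv : Exp X → Exp X

data _≈_ {X : Set} : Exp X → Exp X → Set where
  ≈-refl  : ∀ {e} → e ≈ e
  ≈-sym   : ∀ {e f} → e ≈ f → f ≈ e
  ≈-trans : ∀ {e f g} → e ≈ f → f ≈ g → e ≈ g
  ⊕-cong  : ∀ {e e' f f'} → e ≈ e' → f ≈ f' → e ⊕ f ≈ e' ⊕ f'
  ⊙-cong  : ∀ {e e' f f'} → e ≈ e' → f ≈ f' → e ⊙ f ≈ e' ⊙ f'
  ⊓-cong  : ∀ {e e' f f'} → e ≈ e' → f ≈ f' → e ⊓ f ≈ e' ⊓ f'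
  ⁺-cong  : ∀ {e e'} → e ≈ e' → e ⁺ ≈ e' ⁺
  conv-cong : ∀ {e e'} → e ≈ e' → conv e ≈ conv e'
  ⊕-comm   : ∀ e f → e ⊕ f ≈ f ⊕ e
  ⊕-assoc  : ∀ e f g → e ⊕ (f ⊕ g) ≈ (e ⊕ f) ⊕ g
  ⊕-zero   : ∀ e → e ⊕ 𝟘 ≈ e
  ⊓-comm   : ∀ e f → e ⊓ f ≈ f ⊓ e
  ⊓-idem   : ∀ e → e ⊓ e ≈ e
  ⊓-assoc  : ∀ e f g → e ⊓ (f ⊓ g) ≈ (e ⊓ f) ⊓ g
  ⊓-distr  : ∀ e f g → (e ⊕ f) ⊓ g ≈ e ⊓ g ⊕ f ⊓ g
  absorb   : ∀ e f → (e ⊓ f) ⊕ e ≈ e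
  ⊙-assoc  : ∀ e f g → e ⊙ (f ⊙ g) ≈ (e ⊙ f) ⊙ g
  ⊙-zeroʳ  : ∀ e → e ⊙ 𝟘 ≈ 𝟘
  ⊙-zeroˡ  : ∀ e → 𝟘 ⊙ e ≈ 𝟘
  ⊙-distrʳ : ∀ e f g → (e ⊕ f) ⊙ g ≈ e ⊙ g ⊕ f ⊙ g
  ⊙-distrˡ : ∀ e f g → e ⊙ (f ⊕ g) ≈ e ⊙ f ⊕ e ⊙ g
  ⁺-unfoldˡ : ∀ e → e ⁺ ≈ e ⊕ e ⊙ e ⁺
  ⁺-unfoldʳ : ∀ e → e ⁺ ≈ e ⊕ e ⁺ ⊙ e
  conv-inv  : ∀ e → conv (conv e) ≈ e
  conv-⊕    : ∀ e f → conv (e ⊕ f) ≈ conv e ⊕ conv f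
  conv-⊙    : ∀ e f → conv (e ⊙ f) ≈ conv f ⊙ conv e
  conv-⊓    : ∀ e f → conv (e ⊓ f) ≈ conv e ⊓ conv f
  conv-⁺    : ∀ e → conv (e ⁺) ≈ (conv e) ⁺
  ⊙-unitˡ   : ∀ e → 𝟙 ⊙ e ≈ e
  ⊙-unitʳ   : ∀ e → e ⊙ 𝟙 ≈ e
  𝟙-⊓-⊙     : ∀ e f → 𝟙 ⊓ (e ⊙ f) ≈ 𝟙 ⊓ (e ⊓ f)
  𝟙-⊓-conv  : ∀ e → 𝟙 ⊓ conv e ≈ 𝟙 ⊓ e
  test-comm : ∀ e f → (𝟙 ⊓ e) ⊙ f ≈ f ⊙ (𝟙 ⊓ e)
  test-⊓    : ∀ e f g → ((𝟙 ⊓ e) ⊙ f) ⊓ g ≈ (𝟙 ⊓ e) ⊙ (f ⊓ g)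
  test-⁺    : ∀ e f g → (g ⊕ (𝟙 ⊓ e) ⊙ f) ⁺ ≈ g ⁺ ⊕ (𝟙 ⊓ e) ⊙ (g ⊕ f) ⁺
  ⁺-indˡ : ∀ {e f} → e ⊙ f ⊕ f ≈ f → e ⁺ ⊙ f ⊕ f ≈ f
  ⁺-indʳ : ∀ {e f} → f ⊙ e ⊕ f ≈ f → f ⊙ e ⁺ ⊕ f ≈ f

-- Finite subsets of X are represented as lists, finite sets of them as lists of lists.
-- pairwise unions {A ∪ B : (A,B) ∈ S × T}
_⋓_ : {X : Set} → List (List X) → List (List X) → List (List X)
S ⋓ T = concatMap (λ A → map (λ B → A ++ B) T) S

I : {X : Set} → Exp X → List (List X)
I (var x)  = (x ∷ []) ∷ []
I 𝟘        = []
I 𝟙        = [] ∷ []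
I (e ⊕ f)  = I e ++ I f
I (e ⊙ f)  = I e ⋓ I f
I (e ⊓ f)  = I e ⋓ I f
I (e ⁺)    = I e
I (conv e) = I e

t : {X : Set} → List X → Exp X
t = foldr (λ a r → var a ⊓ r) 𝟙

Σt : {X : Set} → List (List X) → Exp X
Σt = foldr (λ C r → t C ⊕ r) 𝟘

{-# OPTIONS --safe #-}
module Submission where

open import Data.List using (List; []; _∷_; _++_; map)
open import Relation.Binary.Bundles using (Setoid)
import Relation.Binary.Reasoning.Setoid as SetoidReasoning

open import Defs

-- Intersecting with 1 distributes over + and ∩, turns · into ∩ (axiom 1∩(e·f) = 1∩(e∩f)),
-- and ignores converse and ⁺ (unfold e⁺ = e + e·e⁺, then absorb). Dually, sums of the
-- terms t_C are closed under ∩ by distributivity, since t_A ∩ t_B ≈ t_(A∪B).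

≈-setoid : Set → Setoid _ _
≈-setoid X = record
  { Carrier       = Exp X
  ; _≈_           = _≈_
  ; isEquivalence = record { refl = ≈-refl ; sym = ≈-sym ; trans = ≈-trans }
  }

module _ {X : Set} where
  open SetoidReasoning (≈-setoid X)

  ⊓-zeroˡ : (e : Exp X) → 𝟘 ⊓ e ≈ 𝟘
  ⊓-zeroˡ e = ≈-trans (≈-sym (⊕-zero _)) (absorb 𝟘 e)

  ⊓-zeroʳ : (e : Exp X) → e ⊓ 𝟘 ≈ 𝟘
  ⊓-zeroʳ e = ≈-trans (⊓-comm _ _) (⊓-zeroˡ e)

  ⊓-distribˡ : (g e f : Exp X) → g ⊓ (e ⊕ f) ≈ g ⊓ e ⊕ g ⊓ f
  ⊓-distribˡ g e f = begin
    g ⊓ (e ⊕ f)   ≈⟨ ⊓-comm _ _ ⟩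
    (e ⊕ f) ⊓ g   ≈⟨ ⊓-distr e f g ⟩
    e ⊓ g ⊕ f ⊓ g ≈⟨ ⊕-cong (⊓-comm _ _) (⊓-comm _ _) ⟩
    g ⊓ e ⊕ g ⊓ f ∎

  𝟙-⊓-⊓ : (e f : Exp X) → 𝟙 ⊓ (e ⊓ f) ≈ (𝟙 ⊓ e) ⊓ (𝟙 ⊓ f)
  𝟙-⊓-⊓ e f = begin
    𝟙 ⊓ (e ⊓ f)       ≈⟨ ⊓-assoc _ _ _ ⟩
    (𝟙 ⊓ e) ⊓ f       ≈⟨ ⊓-cong (⊓-cong (⊓-idem 𝟙) ≈-refl) ≈-refl ⟨
    ((𝟙 ⊓ 𝟙) ⊓ e) ⊓ f ≈⟨ ⊓-cong (⊓-assoc _ _ _) ≈-refl ⟨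
    (𝟙 ⊓ (𝟙 ⊓ e)) ⊓ f ≈⟨ ⊓-cong (⊓-comm _ _) ≈-refl ⟩
    ((𝟙 ⊓ e) ⊓ 𝟙) ⊓ f ≈⟨ ⊓-assoc _ _ _ ⟨
    (𝟙 ⊓ e) ⊓ (𝟙 ⊓ f) ∎

  𝟙-⊓-⁺ : (e : Exp X) → 𝟙 ⊓ e ⁺ ≈ 𝟙 ⊓ e
  𝟙-⊓-⁺ e = begin
    𝟙 ⊓ e ⁺                ≈⟨ ⊓-cong ≈-refl (⁺-unfoldˡ e) ⟩
    𝟙 ⊓ (e ⊕ e ⊙ e ⁺)      ≈⟨ ⊓-distribˡ _ _ _ ⟩
    𝟙 ⊓ e ⊕ 𝟙 ⊓ (e ⊙ e ⁺)  ≈⟨ ⊕-cong ≈-refl (𝟙-⊓-⊙ _ _) ⟩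
    𝟙 ⊓ e ⊕ 𝟙 ⊓ (e ⊓ e ⁺)  ≈⟨ ⊕-cong ≈-refl (⊓-assoc _ _ _) ⟩
    𝟙 ⊓ e ⊕ (𝟙 ⊓ e) ⊓ e ⁺  ≈⟨ ⊕-comm _ _ ⟩
    (𝟙 ⊓ e) ⊓ e ⁺ ⊕ 𝟙 ⊓ e  ≈⟨ absorb _ _ ⟩
    𝟙 ⊓ e                  ∎

  𝟙-⊓-t : (A : List X) → 𝟙 ⊓ t A ≈ t A
  𝟙-⊓-t []      = ⊓-idem 𝟙
  𝟙-⊓-t (a ∷ A) = begin
    𝟙 ⊓ (var a ⊓ t A) ≈⟨ ⊓-assoc _ _ _ ⟩
    (𝟙 ⊓ var a) ⊓ t A ≈⟨ ⊓-cong (⊓-comm _ _) ≈-refl ⟩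
    (var a ⊓ 𝟙) ⊓ t A ≈⟨ ⊓-assoc _ _ _ ⟨
    var a ⊓ (𝟙 ⊓ t A) ≈⟨ ⊓-cong ≈-refl (𝟙-⊓-t A) ⟩
    var a ⊓ t A       ∎

  t-++ : (A B : List X) → t A ⊓ t B ≈ t (A ++ B)
  t-++ []      B = 𝟙-⊓-t B
  t-++ (a ∷ A) B = ≈-trans (≈-sym (⊓-assoc _ _ _)) (⊓-cong ≈-refl (t-++ A B))

  Σt-++ : (S T : List (List X)) → Σt (S ++ T) ≈ Σt S ⊕ Σt T
  Σt-++ []      T = ≈-trans (≈-sym (⊕-zero _)) (⊕-comm _ _)
  Σt-++ (A ∷ S) T = ≈-trans (⊕-cong ≈-refl (Σt-++ S T)) (⊕-assoc _ _ _)

  t-⊓-Σt : (A : List X) (T : List (List X)) → t A ⊓ Σt T ≈ Σt (map (A ++_) T)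
  t-⊓-Σt A []      = ⊓-zeroʳ _
  t-⊓-Σt A (B ∷ T) = ≈-trans (⊓-distribˡ _ _ _) (⊕-cong (t-++ A B) (t-⊓-Σt A T))

  Σt-⊓-Σt : (S T : List (List X)) → Σt S ⊓ Σt T ≈ Σt (S ⋓ T)
  Σt-⊓-Σt []      T = ⊓-zeroˡ _
  Σt-⊓-Σt (A ∷ S) T = begin
    (t A ⊕ Σt S) ⊓ Σt T                ≈⟨ ⊓-distr _ _ _ ⟩
    t A ⊓ Σt T ⊕ Σt S ⊓ Σt T           ≈⟨ ⊕-cong (t-⊓-Σt A T) (Σt-⊓-Σt S T) ⟩
    Σt (map (A ++_) T) ⊕ Σt (S ⋓ T)    ≈⟨ Σt-++ (map (A ++_) T) (S ⋓ T) ⟨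
    Σt ((A ∷ S) ⋓ T)                   ∎

  𝟙-⊓-⊓-Σt : {e f : Exp X} (S T : List (List X)) →
             𝟙 ⊓ e ≈ Σt S → 𝟙 ⊓ f ≈ Σt T → 𝟙 ⊓ (e ⊓ f) ≈ Σt (S ⋓ T)
  𝟙-⊓-⊓-Σt {e} {f} S T e≈S f≈T = begin
    𝟙 ⊓ (e ⊓ f)       ≈⟨ 𝟙-⊓-⊓ e f ⟩
    (𝟙 ⊓ e) ⊓ (𝟙 ⊓ f) ≈⟨ ⊓-cong e≈S f≈T ⟩
    Σt S ⊓ Σt T       ≈⟨ Σt-⊓-Σt S T ⟩
    Σt (S ⋓ T)        ∎

lemma13 : {X : Set} (e : Exp X) → 𝟙 ⊓ e ≈ Σt (I e)
lemma13 (var x)  = ≈-trans (⊓-comm _ _) (≈-sym (⊕-zero _))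
lemma13 𝟘        = ⊓-zeroʳ 𝟙
lemma13 𝟙        = ≈-trans (⊓-idem 𝟙) (≈-sym (⊕-zero _))
lemma13 (e ⊕ f)  = ≈-trans (⊓-distribˡ 𝟙 e f)
                     (≈-trans (⊕-cong (lemma13 e) (lemma13 f)) (≈-sym (Σt-++ (I e) (I f))))
lemma13 (e ⊙ f)  = ≈-trans (𝟙-⊓-⊙ e f) (𝟙-⊓-⊓-Σt (I e) (I f) (lemma13 e) (lemma13 f))
lemma13 (e ⊓ f)  = 𝟙-⊓-⊓-Σt (I e) (I f) (lemma13 e) (lemma13 f)
lemma13 (e ⁺)    = ≈-trans (𝟙-⊓-⁺ e) (lemma13 e)
lemma13 (conv e) = ≈-trans (𝟙-⊓-conv e) (lemma13 e)
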